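{- Let $G$ be a $k$-partite graph with given partite sets $V_1,\dots,V_k$, and let $<$ be a linear ordering of $V(G)$ containing no triple $v_a<v_b<v_c$ with $v_av_c\in E(G)$, $v_b$ and $v_c$ in different partite sets, and $v_bv_c\notin E(G)$. If $(u,v)\rightarrow(u',v')$ is an arc of the pair-digraph $G^+$ and $u<v$, then $u'<v'$.
   Context: Throughout, $G$ is a graph with a given partition of $V(G)$ into independent sets (partite sets) $V_1,\dots,V_k$; $c(u)$ denotes the index of the partite set containing $u$. Let $\bar E=\{uv: u\in V_i, v\in V_j, i\neq j\}\setminus E(G)$. The pair-digraph $G^+$ has vertex set all ordered pairs $(u,v)$ with $u,v\in V(G)$, $u\ne v$, and its arcs are: (i) $(u,v)\to(u',v)$ whenever $c(u)=c(v)$, $uu'\in E(G)$ and $vu'\notin E(G)$; (ii) $(u,v)\to(u',v)$ whenever $uu'\in E(G)$, $u'v\in\bar E$, and $u,v,u'$ lie in three different partite sets; (iii) $(u,v)\to(u,v')$ whenever $c(u)=c(v')$, $vv'\in E(G)$ and $uv\notin E(G)$; (iv) $(u,v)\to(u,v')$ whenever $vv'\in E(G)$, $uv\in\bar E$, and $u,v,v'$ lie in three different partite sets. -}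

module Defs where

open import Data.Nat using (ℕ)
open import Data.Fin using (Fin)
open import Data.Product using (_×_)
open import Relation.Nullary using (¬_)
open import Relation.Binary.PropositionalEquality using (_≡_; _≢_)
open import Level using (0ℓ)
open import Relation.Binary using (Rel; Symmetric; Irreflexive)

-- A finite simple graph on vertex set Fin n, with a partition of the
-- vertex set into k partite sets V_1..V_k given by the colouring c
-- (c u = index of the partite set containing u).
record KPartiteGraph (n k : ℕ) : Set₁ where
  field
    E      : Rel (Fin n) 0ℓ
    E-sym  : Symmetric E
    E-irr  : Irreflexive _≡_ E
    c      : Fin n → Fin k
    indep  : ∀ {u v} → E u v → c u ≢ c v

module _ {n k : ℕ} (G : KPartiteGraph n k) where
  open KPartiteGraph G

  Ebar : Fin n → Fin n → Set
  Ebar u v = c u ≢ c v × ¬ E u v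

  ThreeParts : Fin n → Fin n → Fin n → Set
  ThreeParts x y z = c x ≢ c y × c x ≢ c z × c y ≢ c z

  -- Vertices of G⁺: ordered pairs (u , v) with u ≠ v.
  -- Arcs of G⁺, rules (i)–(iv).
  data Arc : Fin n → Fin n → Fin n → Fin n → Set where
    arc-i   : ∀ {u v u'} → u ≢ v → u' ≢ v → c u ≡ c v → E u u' → ¬ E v u'
            → Arc u v u' v
    arc-ii  : ∀ {u v u'} → u ≢ v → u' ≢ v → E u u' → Ebar u' v → ThreeParts u v u'
            → Arc u v u' v
    arc-iii : ∀ {u v v'} → u ≢ v → u ≢ v' → c u ≡ c v' → E v v' → ¬ E u v
            → Arc u v u v'
    arc-iv  : ∀ {u v v'} → u ≢ v → u ≢ v' → E v v' → Ebar u v → ThreeParts u v v'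
            → Arc u v u v'

  NoBadTriple : Rel (Fin n) 0ℓ → Set
  NoBadTriple _<_ = ∀ a b c' → ¬ (a < b × b < c' × E a c' × c b ≢ c c' × ¬ E b c')

{-# OPTIONS --safe #-}

-- An arc of G⁺ moves one coordinate along an edge.  If the order were
-- reversed, the old edge endpoint, the fixed coordinate and the new
-- endpoint would form a forbidden triple.

module Submission where

open import Defs
open import Data.Nat using (ℕ)
open import Data.Fin using (Fin)
open import Data.Product using (_,_)
open import Data.Empty using (⊥-elim)
open import Function using (_∘_)
open import Level using (0ℓ)
open import Relation.Nullary using (¬_)
open import Relation.Binary using (Rel; IsStrictTotalOrder; tri<; tri≈; tri>)
open import Relation.Binary.PropositionalEquality using (_≡_; _≢_; sym; trans; ≢-sym)

module _ {A : Set} {_<_ : Rel A 0ℓ} (<-sto : IsStrictTotalOrder _≡_ _<_) where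

  ≢∧≯⇒< : ∀ {x y} → x ≢ y → ¬ (y < x) → x < y
  ≢∧≯⇒< {x} {y} x≢y y≮x with IsStrictTotalOrder.compare <-sto x y
  ... | tri< x<y _ _ = x<y
  ... | tri≈ _ x≡y _ = ⊥-elim (x≢y x≡y)
  ... | tri> _ _ y<x = ⊥-elim (y≮x y<x)

module _ {n k : ℕ} (G : KPartiteGraph n k) where
  open KPartiteGraph G

  sameSide-≢ : ∀ {x y z} → c x ≡ c y → E y z → c x ≢ c z
  sameSide-≢ cx≡cy yz cx≡cz = indep yz (trans (sym cx≡cy) cx≡cz)

  module _ {_<_ : Rel (Fin n) 0ℓ} (<-sto : IsStrictTotalOrder _≡_ _<_)
           (noBad : NoBadTriple G _<_) where

    moveFirst-< : ∀ {u v u'} → u < v → E u u' → c v ≢ c u' → ¬ E v u' → u' ≢ v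
                → u' < v
    moveFirst-< u<v uu' cv≢cu' ¬vu' u'≢v =
      ≢∧≯⇒< <-sto u'≢v λ v<u' → noBad _ _ _ (u<v , v<u' , uu' , cv≢cu' , ¬vu')

    moveSecond-< : ∀ {u v v'} → u < v → E v v' → c u ≢ c v → ¬ E u v → u ≢ v'
                 → u < v'
    moveSecond-< u<v vv' cu≢cv ¬uv u≢v' =
      ≢∧≯⇒< <-sto u≢v' λ v'<u → noBad _ _ _ (v'<u , u<v , E-sym vv' , cu≢cv , ¬uv)

open KPartiteGraph using (E-sym)

lemma1 : ∀ {n k : ℕ} (G : KPartiteGraph n k) (_<_ : Rel (Fin n) 0ℓ)
         → IsStrictTotalOrder _≡_ _<_
         → NoBadTriple G _<_
         → ∀ {u v u' v'} → Arc G u v u' v' → u < v → u' < v'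
lemma1 G _<_ <-sto noBad (arc-i _ u'≢v cu≡cv uu' ¬vu') u<v =
  moveFirst-< G <-sto noBad u<v uu' (sameSide-≢ G (sym cu≡cv) uu') ¬vu' u'≢v
lemma1 G _<_ <-sto noBad (arc-ii _ u'≢v uu' (cu'≢cv , ¬u'v) _) u<v =
  moveFirst-< G <-sto noBad u<v uu' (≢-sym cu'≢cv) (¬u'v ∘ E-sym G) u'≢v
lemma1 G _<_ <-sto noBad (arc-iii _ u≢v' cu≡cv' vv' ¬uv) u<v =
  moveSecond-< G <-sto noBad u<v vv' (sameSide-≢ G cu≡cv' (E-sym G vv')) ¬uv u≢v'
lemma1 G _<_ <-sto noBad (arc-iv _ u≢v' vv' (cu≢cv , ¬uv) _) u<v =
  moveSecond-< G <-sto noBad u<v vv' cu≢cv ¬uv u≢v'
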